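{- Let $m\ge2$ be an integer and let $v_1,v_2,\dots,v_{2m}$ be a sequence of vertices in a finite loop-free multigraph. Suppose: (a) $v_1$ is distinct from all of $v_2,v_3,\dots,v_{2m}$; (b) $v_i\ne v_{i+1}$ for $i=1,\dots,2m-1$, and the unordered pairs $\{v_i,v_{i+1}\}$, $i=1,\dots,2m-1$, are all distinct from each other and from $\{v_1,v_{2m}\}$; (c) there is an edge of type $\{v_{2j},v_{2j+1}\}$ for each $j=1,\dots,m-1$; (d) the type $\{v_1,v_{2m}\}$ has multiplicity at least two. Then there is a finite sequence of admissible double edge swaps that reduces the multiplicity of $\{v_1,v_{2m}\}$ by one without adding any new non-simple edge, except possibly edges of types $\{v_{2j-1},v_{2j}\}$, $j=1,\dots,m$, of which at least one edge was already present in the original multigraph.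
   Context: A loop-free multigraph is a finite undirected graph without loops in which several edges may join the same pair of distinct vertices. The type of an edge joining $u,v$ is the unordered pair $\{u,v\}$ and its multiplicity is the number of edges of that type. An edge is simple if its type has multiplicity one and non-simple if its type has multiplicity at least two. Given two distinct edges of types $\{a_1,a_2\}$ and $\{a_3,a_4\}$, the double edge swap $(a_1,a_2)(a_3,a_4)$ removes them and adds edges of types $\{a_2,a_3\}$ and $\{a_4,a_1\}$; it is admissible if the two removed edges share no endpoint and not both of them are simple (before the swap). -}

module Defs where

open import Data.Nat using (ℕ; zero; suc; _+_; _*_; _≤_; _<_)
open import Data.Fin using (Fin; _≟_)
open import Data.Bool using (Bool; true; false; if_then_else_; _∧_; _∨_)
open import Data.Product using (_×_; Σ; ∃; ∃-syntax; _,_)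
open import Data.Sum using (_⊎_)
open import Relation.Nullary using (¬_; does)
open import Relation.Binary.PropositionalEquality using (_≡_; _≢_)
open import Relation.Binary.Construct.Closure.ReflexiveTransitive using (Star)

record Multigraph (n : ℕ) : Set where
  field
    mult     : Fin n → Fin n → ℕ
    mult-sym : ∀ x y → mult x y ≡ mult y x
    loopless : ∀ x → mult x x ≡ 0
open Multigraph public

SameType : ∀ {n} → Fin n → Fin n → Fin n → Fin n → Set
SameType x y a b = (x ≡ a × y ≡ b) ⊎ (x ≡ b × y ≡ a)

sameType? : ∀ {n} → Fin n → Fin n → Fin n → Fin n → Bool
sameType? x y a b = (does (x ≟ a) ∧ does (y ≟ b)) ∨ (does (x ≟ b) ∧ does (y ≟ a))

ind : ∀ {n} → Fin n → Fin n → Fin n → Fin n → ℕ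
ind x y a b = if sameType? x y a b then 1 else 0

Admissible : ∀ {n} → Multigraph n → Fin n → Fin n → Fin n → Fin n → Set
Admissible G a₁ a₂ a₃ a₄ =
  (a₁ ≢ a₂) × (a₁ ≢ a₃) × (a₁ ≢ a₄) × (a₂ ≢ a₃) × (a₂ ≢ a₄) × (a₃ ≢ a₄) ×
  (1 ≤ mult G a₁ a₂) × (1 ≤ mult G a₃ a₄) ×
  ((2 ≤ mult G a₁ a₂) ⊎ (2 ≤ mult G a₃ a₄))

-- H is the result of applying the swap (a₁,a₂)(a₃,a₄) to G: one edge of each
-- of the types {a₁,a₂}, {a₃,a₄} removed, one edge of each of {a₂,a₃}, {a₄,a₁} added.
SwapResult : ∀ {n} → Multigraph n → Fin n → Fin n → Fin n → Fin n → Multigraph n → Set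
SwapResult G a₁ a₂ a₃ a₄ H = ∀ x y →
  mult H x y + ind x y a₁ a₂ + ind x y a₃ a₄ ≡ mult G x y + ind x y a₂ a₃ + ind x y a₄ a₁

AdmissibleSwap : ∀ {n} → Multigraph n → Multigraph n → Set
AdmissibleSwap G H = ∃[ a₁ ] ∃[ a₂ ] ∃[ a₃ ] ∃[ a₄ ]
  (Admissible G a₁ a₂ a₃ a₄ × SwapResult G a₁ a₂ a₃ a₄ H)

AdmissibleSwaps : ∀ {n} → Multigraph n → Multigraph n → Set
AdmissibleSwaps = Star AdmissibleSwap

-- Swap (v₁,v₂ₘ)(v₂ₘ₋₁,v₂ₘ₋₂). It removes a copy of {v₁,v₂ₘ} and of the present
-- even edge {v₂ₘ₋₂,v₂ₘ₋₁}, and adds the odd edge {v₂ₘ₋₁,v₂ₘ} and {v₁,v₂ₘ₋₂}. If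
-- {v₁,v₂ₘ₋₂} was absent, or is the first edge {v₁,v₂}, we are done. Otherwise it
-- is now non-simple and the same argument applied to the shorter path v₁,…,v₂ₘ₋₂
-- removes that copy again. To compose the two steps, the induction also records
-- that every type off the path other than {v₁,v₂ₘ} is at most created from
-- nothing; in particular the inner swaps leave {v₁,v₂ₘ} alone.

module Submission where

open import Defs
open import Data.Nat using (ℕ; zero; suc; _+_; _*_; _∸_; _≤_; _<_; z≤n; s≤s; _≟_)
open import Data.Nat.Properties
open import Data.Fin using (Fin) renaming (_≟_ to _≟ᶠ_)
open import Data.Bool using (if_then_else_)
open import Data.Empty using (⊥-elim)
open import Data.Product using (_×_; ∃-syntax; _,_)
open import Data.Sum using (_⊎_; inj₁; inj₂)
open import Function using (_∘_)
open import Relation.Nullary using (¬_; Dec; yes; no)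
open import Relation.Nullary.Decidable using (_×-dec_; _⊎-dec_; dec-true; dec-false)
open import Relation.Binary.PropositionalEquality
open import Relation.Binary.Construct.Closure.ReflexiveTransitive using (ε; _◅_)

module _ {n : ℕ} where

  sameType-dec : (x y a b : Fin n) → Dec (SameType x y a b)
  sameType-dec x y a b = ((x ≟ᶠ a) ×-dec (y ≟ᶠ b)) ⊎-dec ((x ≟ᶠ b) ×-dec (y ≟ᶠ a))

  sameType-refl : {a b : Fin n} → SameType a b a b
  sameType-refl = inj₁ (refl , refl)

  sameType-swap : {x y a b : Fin n} → SameType x y a b → SameType y x a b
  sameType-swap (inj₁ (p , q)) = inj₂ (q , p)
  sameType-swap (inj₂ (p , q)) = inj₁ (q , p)

  sameType-flip : {x y a b : Fin n} → SameType x y a b → SameType x y b a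
  sameType-flip (inj₁ pq) = inj₂ pq
  sameType-flip (inj₂ pq) = inj₁ pq

  sameType-trans : {x y a b c d : Fin n} → SameType x y a b → SameType x y c d → SameType a b c d
  sameType-trans (inj₁ (refl , refl)) t = t
  sameType-trans (inj₂ (refl , refl)) t = sameType-swap t

  ¬sameType-fst : {x y a b : Fin n} → x ≢ a → y ≢ a → ¬ SameType x y a b
  ¬sameType-fst x≢a _ (inj₁ (x≡a , _)) = x≢a x≡a
  ¬sameType-fst _ y≢a (inj₂ (_ , y≡a)) = y≢a y≡a

  ¬sameType-snd : {x y a b : Fin n} → x ≢ b → y ≢ b → ¬ SameType x y a b
  ¬sameType-snd x≢b y≢b = ¬sameType-fst x≢b y≢b ∘ sameType-flip

  mult-resp-sameType : (G : Multigraph n) {x y a b : Fin n} →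
                       SameType x y a b → mult G x y ≡ mult G a b
  mult-resp-sameType G (inj₁ (refl , refl)) = refl
  mult-resp-sameType G {x} {y} (inj₂ (refl , refl)) = mult-sym G x y

  ind-yes : {x y a b : Fin n} → SameType x y a b → ind x y a b ≡ 1
  ind-yes {x} {y} {a} {b} s = cong (λ t → if t then 1 else 0) (dec-true (sameType-dec x y a b) s)

  ind-no : {x y a b : Fin n} → ¬ SameType x y a b → ind x y a b ≡ 0
  ind-no {x} {y} {a} {b} s = cong (λ t → if t then 1 else 0) (dec-false (sameType-dec x y a b) s)

  ind-swap : (x y a b : Fin n) → ind x y a b ≡ ind y x a b
  ind-swap x y a b with sameType-dec x y a b
  ... | yes s = trans (ind-yes s) (sym (ind-yes (sameType-swap s)))
  ... | no ¬s = trans (ind-no ¬s) (sym (ind-no (¬s ∘ sameType-swap)))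

  ind-loop : (x : Fin n) {a b : Fin n} → a ≢ b → ind x x a b ≡ 0
  ind-loop x a≢b = ind-no {x = x} λ where
    (inj₁ (x≡a , x≡b)) → a≢b (trans (sym x≡a) x≡b)
    (inj₂ (x≡b , x≡a)) → a≢b (trans (sym x≡a) x≡b)

module SwapFacts {n : ℕ} {G H : Multigraph n} {a₁ a₂ a₃ a₄ : Fin n}
                 (res : SwapResult G a₁ a₂ a₃ a₄ H) {x y : Fin n} where

  private
    indicators : (a b c d : Fin n) → ℕ
    indicators a b c d = ind x y a b + ind x y c d

    indicators-no : ∀ {a b c d} → ¬ SameType x y a b → ¬ SameType x y c d → indicators a b c d ≡ 0
    indicators-no s t = cong₂ _+_ (ind-no s) (ind-no t)

    balance : ∀ {r s} → indicators a₁ a₂ a₃ a₄ ≡ r → indicators a₂ a₃ a₄ a₁ ≡ s →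
              r + mult H x y ≡ s + mult G x y
    balance refl refl = begin
      indicators a₁ a₂ a₃ a₄ + mult H x y    ≡⟨ +-comm _ (mult H x y) ⟩
      mult H x y + indicators a₁ a₂ a₃ a₄    ≡⟨ +-assoc (mult H x y) _ _ ⟨
      mult H x y + ind x y a₁ a₂ + ind x y a₃ a₄ ≡⟨ res x y ⟩
      mult G x y + ind x y a₂ a₃ + ind x y a₄ a₁ ≡⟨ +-assoc (mult G x y) _ _ ⟩
      mult G x y + indicators a₂ a₃ a₄ a₁    ≡⟨ +-comm (mult G x y) _ ⟩
      indicators a₂ a₃ a₄ a₁ + mult G x y    ∎
      where open ≡-Reasoning

    gain : ∀ {s} → indicators a₂ a₃ a₄ a₁ ≡ s → mult H x y ≤ s + mult G x y
    gain e = ≤-trans (m≤n+m (mult H x y) _) (≤-reflexive (balance refl e))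

  swap-untouched : ¬ SameType x y a₁ a₂ → ¬ SameType x y a₃ a₄ →
                   ¬ SameType x y a₂ a₃ → ¬ SameType x y a₄ a₁ → mult H x y ≡ mult G x y
  swap-untouched s₁₂ s₃₄ s₂₃ s₄₁ = balance (indicators-no s₁₂ s₃₄) (indicators-no s₂₃ s₄₁)

  swap-removed : SameType x y a₁ a₂ → ¬ SameType x y a₃ a₄ →
                 ¬ SameType x y a₂ a₃ → ¬ SameType x y a₄ a₁ → suc (mult H x y) ≡ mult G x y
  swap-removed s₁₂ s₃₄ s₂₃ s₄₁ =
    balance (cong₂ _+_ (ind-yes s₁₂) (ind-no s₃₄)) (indicators-no s₂₃ s₄₁)

  swap-added : ¬ SameType x y a₁ a₂ → ¬ SameType x y a₃ a₄ →
               ¬ SameType x y a₂ a₃ → SameType x y a₄ a₁ → mult H x y ≡ suc (mult G x y)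
  swap-added s₁₂ s₃₄ s₂₃ s₄₁ =
    balance (indicators-no s₁₂ s₃₄) (cong₂ _+_ (ind-no s₂₃) (ind-yes s₄₁))

  swap-monotone : ¬ SameType x y a₁ a₂ → ¬ SameType x y a₃ a₄ → mult G x y ≤ mult H x y
  swap-monotone s₁₂ s₃₄ =
    ≤-trans (m≤n+m (mult G x y) _) (≤-reflexive (sym (balance (indicators-no s₁₂ s₃₄) refl)))

  swap-bound : a₁ ≢ a₂ → a₂ ≢ a₄ →
               mult H x y ≤ mult G x y ⊎
               (mult H x y ≤ suc (mult G x y) × (SameType x y a₂ a₃ ⊎ SameType x y a₄ a₁))
  swap-bound a₁≢a₂ a₂≢a₄ with sameType-dec x y a₂ a₃ | sameType-dec x y a₄ a₁
  ... | yes s | yes t with sameType-trans s t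
  ...   | inj₁ (a₂≡a₄ , _) = ⊥-elim (a₂≢a₄ a₂≡a₄)
  ...   | inj₂ (a₂≡a₁ , _) = ⊥-elim (a₁≢a₂ (sym a₂≡a₁))
  swap-bound _ _ | yes s | no t = inj₂ (gain (cong₂ _+_ (ind-yes s) (ind-no t)) , inj₁ s)
  swap-bound _ _ | no s | yes t = inj₂ (gain (cong₂ _+_ (ind-no s) (ind-yes t)) , inj₂ t)
  swap-bound _ _ | no s | no t = inj₁ (gain (indicators-no s t))

swap-exists : ∀ {n} (G : Multigraph n) {a₁ a₂ a₃ a₄ : Fin n} →
              Admissible G a₁ a₂ a₃ a₄ → ∃[ H ] SwapResult G a₁ a₂ a₃ a₄ H
swap-exists {n} G {a₁} {a₂} {a₃} {a₄} (a₁≢a₂ , a₁≢a₃ , a₁≢a₄ , a₂≢a₃ , _ , a₃≢a₄ , e₁₂ , e₃₄ , _) =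
  H , λ x y → trans (+-assoc (mult H x y) _ _) (m∸n+n≡m (removed≤new x y))
  where
  removed≤old : ∀ x y → ind x y a₁ a₂ + ind x y a₃ a₄ ≤ mult G x y
  removed≤old x y with sameType-dec x y a₁ a₂ | sameType-dec x y a₃ a₄
  ... | yes s | yes t = ⊥-elim (¬sameType-fst a₁≢a₃ a₂≢a₃ (sameType-trans s t))
  ... | yes s | no t rewrite ind-yes s | ind-no t | mult-resp-sameType G s = e₁₂
  ... | no s | yes t rewrite ind-no s | ind-yes t | mult-resp-sameType G t = e₃₄
  ... | no s | no t rewrite ind-no s | ind-no t = z≤n

  new : Fin n → Fin n → ℕ
  new x y = mult G x y + ind x y a₂ a₃ + ind x y a₄ a₁

  removed≤new : ∀ x y → ind x y a₁ a₂ + ind x y a₃ a₄ ≤ new x y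
  removed≤new x y = ≤-trans (removed≤old x y) (≤-trans (m≤m+n _ _) (m≤m+n _ _))

  swapped : Fin n → Fin n → ℕ
  swapped x y = new x y ∸ (ind x y a₁ a₂ + ind x y a₃ a₄)

  swapped-sym : ∀ x y → swapped x y ≡ swapped y x
  swapped-sym x y rewrite mult-sym G x y | ind-swap x y a₁ a₂ | ind-swap x y a₂ a₃
                        | ind-swap x y a₃ a₄ | ind-swap x y a₄ a₁ = refl

  swapped-loopless : ∀ x → swapped x x ≡ 0
  swapped-loopless x rewrite loopless G x | ind-loop x a₁≢a₂ | ind-loop x a₂≢a₃
                           | ind-loop x a₃≢a₄ | ind-loop x (a₁≢a₄ ∘ sym) = refl

  H : Multigraph n
  H = record { mult = swapped ; mult-sym = swapped-sym ; loopless = swapped-loopless }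

≤∸1⇒< : ∀ {j k} → 1 ≤ j → j ≤ k ∸ 1 → j < k
≤∸1⇒< {k = suc k} _      j≤k = s≤s j≤k
≤∸1⇒< {k = zero}  (s≤s _) ()

KeptOrCreated : ℕ → ℕ → Set
KeptOrCreated g h = h ≡ g ⊎ (g ≡ 0 × h ≡ 1)

module _ {n : ℕ} (v : ℕ → Fin n) where

  record PathConditions (k : ℕ) : Set where
    field
      start-fresh    : ∀ i → 2 ≤ i → i ≤ 2 * k → v 1 ≢ v i
      steps-loopless : ∀ i → 1 ≤ i → i < 2 * k → v i ≢ v (suc i)
      steps-distinct : ∀ i j → 1 ≤ i → i < j → j < 2 * k →
                       ¬ SameType (v i) (v (suc i)) (v j) (v (suc j))

  PathConditions-mono : ∀ {k l} → k ≤ l → PathConditions l → PathConditions k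
  PathConditions-mono k≤l P = record
    { start-fresh    = λ i 2≤i i≤ → start-fresh i 2≤i (≤-trans i≤ 2k≤2l)
    ; steps-loopless = λ i 1≤i i< → steps-loopless i 1≤i (<-≤-trans i< 2k≤2l)
    ; steps-distinct = λ i j 1≤i i<j j< → steps-distinct i j 1≤i i<j (<-≤-trans j< 2k≤2l)
    }
    where
    open PathConditions P
    2k≤2l = *-monoʳ-≤ 2 k≤l

  PathEdge : ℕ → Fin n → Fin n → Set
  PathEdge N x y = ∃[ i ] (1 ≤ i × i < N × SameType x y (v i) (v (suc i)))

  PathEdge-mono : ∀ {N N' x y} → N ≤ N' → PathEdge N x y → PathEdge N' x y
  PathEdge-mono N≤N' (i , 1≤i , i<N , s) = i , 1≤i , <-≤-trans i<N N≤N' , s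

  OddEdgePresent : ℕ → Multigraph n → Fin n → Fin n → Set
  OddEdgePresent k G x y =
    ∃[ j ] (1 ≤ j × j ≤ k × SameType x y (v (2 * j ∸ 1)) (v (2 * j)) × 1 ≤ mult G x y)

  EvenEdgesPresent : ℕ → Multigraph n → Set
  EvenEdgesPresent k G = ∀ j → 1 ≤ j → j ≤ k ∸ 1 → 1 ≤ mult G (v (2 * j)) (v (suc (2 * j)))

  odd-edge-on-path : ∀ {k j x y} → 1 ≤ j → j ≤ k →
                     SameType x y (v (2 * j ∸ 1)) (v (2 * j)) → PathEdge (2 * k) x y
  odd-edge-on-path {k} {suc j} {x} {y} _ j≤k s =
    suc (2 * j) , s≤s z≤n , subst (_≤ 2 * k) (*-suc 2 j) (*-monoʳ-≤ 2 j≤k) ,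
    subst (λ t → SameType x y (v (t ∸ 1)) (v t)) (*-suc 2 j) s

  closing-edge-off-path : ∀ {k} → PathConditions k → v 2 ≢ v (2 * k) →
                          ¬ PathEdge (2 * k) (v 1) (v (2 * k))
  closing-edge-off-path P v2≢B (suc zero , _ , _ , inj₁ (_ , B≡v2)) = v2≢B (sym B≡v2)
  closing-edge-off-path P _ (suc (suc i) , _ , i<N , inj₁ (A≡vi , _)) =
    PathConditions.start-fresh P (suc (suc i)) (s≤s (s≤s z≤n)) (<⇒≤ i<N) A≡vi
  closing-edge-off-path P _ (i , 1≤i , i<N , inj₂ (A≡vi+1 , _)) =
    PathConditions.start-fresh P (suc i) (s≤s 1≤i) i<N A≡vi+1

  record Reduces (k : ℕ) (G H : Multigraph n) : Set where
    field
      target-reduced : suc (mult H (v 1) (v (2 * k))) ≡ mult G (v 1) (v (2 * k))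
      no-new-multi   : ∀ x y → 2 ≤ mult H x y → mult H x y ≤ mult G x y ⊎ OddEdgePresent k G x y
      off-path-kept  : ∀ x y → ¬ PathEdge (2 * k) x y → ¬ SameType x y (v 1) (v (2 * k)) →
                       KeptOrCreated (mult G x y) (mult H x y)

  module Level {k : ℕ} (P : PathConditions (suc k)) (1≤k : 1 ≤ k) where
    open PathConditions P

    d : ℕ
    d = 2 * k

    A B C D : Fin n
    A = v 1
    B = v (2 * suc k)
    C = v (suc d)
    D = v d

    top≡ : 2 * suc k ≡ suc (suc d)
    top≡ = *-suc 2 k

    2≤d : 2 ≤ d
    2≤d = *-monoʳ-≤ 2 1≤k

    1≤d : 1 ≤ d
    1≤d = ≤-trans (s≤s z≤n) 2≤d

    d<top : d < 2 * suc k
    d<top = *-monoʳ-< 2 (n<1+n k)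

    1+d<top : suc d < 2 * suc k
    1+d<top = subst (suc d <_) (sym top≡) (n<1+n (suc d))

    A≢B : A ≢ B
    A≢B = start-fresh (2 * suc k) (≤-trans 2≤d (<⇒≤ d<top)) ≤-refl

    A≢C : A ≢ C
    A≢C = start-fresh (suc d) (m≤n⇒m≤1+n 2≤d) (<⇒≤ 1+d<top)

    A≢D : A ≢ D
    A≢D = start-fresh d 2≤d (<⇒≤ d<top)

    B≢C : B ≢ C
    B≢C B≡C = steps-loopless (suc d) (s≤s z≤n) 1+d<top (trans (sym B≡C) (cong v top≡))

    B≢D : B ≢ D
    B≢D B≡D = steps-distinct d (suc d) 1≤d ≤-refl 1+d<top
                             (inj₂ (trans (sym B≡D) (cong v top≡) , refl))

    C≢D : C ≢ D
    C≢D = ≢-sym (steps-loopless d 1≤d d<top)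

    admissible : ∀ G → EvenEdgesPresent (suc k) G → 2 ≤ mult G A B → Admissible G A B C D
    admissible G hc hd = A≢B , A≢C , A≢D , B≢C , B≢D , C≢D , ≤-trans (s≤s z≤n) hd ,
                           subst (1 ≤_) (mult-sym G D C) (hc k 1≤k ≤-refl) , inj₁ hd

    CD-on-path : ∀ {x y} → SameType x y C D → PathEdge (2 * suc k) x y
    CD-on-path s = d , 1≤d , d<top , sameType-flip s

    BC-edge : ∀ {x y} → SameType x y B C → SameType x y (v (suc d)) (v (suc (suc d)))
    BC-edge {x} {y} s = subst (SameType x y C) (cong v top≡) (sameType-flip s)

    BC-on-path : ∀ {x y} → SameType x y B C → PathEdge (2 * suc k) x y
    BC-on-path s = suc d , s≤s z≤n , 1+d<top , BC-edge s

    BC-not-earlier : ∀ {x y} → PathEdge (2 * k) x y → ¬ SameType x y B C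
    BC-not-earlier (i , 1≤i , i<d , s) t =
      steps-distinct i (suc d) 1≤i (m<n⇒m<1+n i<d) 1+d<top (sameType-trans s (BC-edge t))

    module AfterSwap {G H : Multigraph n} (res : SwapResult G A B C D H) where
      open SwapFacts {G = G} {H = H} res

      target-removed : suc (mult H A B) ≡ mult G A B
      target-removed = swap-removed sameType-refl (¬sameType-fst A≢C B≢C)
                                    (¬sameType-snd A≢C B≢C) (¬sameType-fst A≢D B≢D)

      AD-added : mult H A D ≡ suc (mult G A D)
      AD-added = swap-added (¬sameType-snd A≢B (≢-sym B≢D)) (¬sameType-fst A≢C (≢-sym C≢D))
                            (¬sameType-snd A≢C (≢-sym C≢D)) (inj₂ (refl , refl))

      AD-multiple : 1 ≤ mult G A D → 2 ≤ mult H A D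
      AD-multiple 1≤AD = subst (2 ≤_) (sym AD-added) (s≤s 1≤AD)

      off-path-untouched : ∀ {x y} → ¬ PathEdge (2 * suc k) x y → ¬ SameType x y A B →
                           ¬ SameType x y D A → mult H x y ≡ mult G x y
      off-path-untouched ¬path ¬AB ¬DA =
        swap-untouched ¬AB (¬path ∘ CD-on-path) (¬path ∘ BC-on-path) ¬DA

      odd-edge-at-top : ∀ {x y} → 2 ≤ mult H x y → mult H x y ≤ suc (mult G x y) →
                        SameType x y B C → OddEdgePresent (suc k) G x y
      odd-edge-at-top {x = x} {y} 2≤H H≤1+G s =
        suc k , s≤s z≤n , ≤-refl ,
        subst (λ t → SameType x y (v (t ∸ 1)) B) (sym top≡) (sameType-flip s) ,
        ≤-pred (≤-trans 2≤H H≤1+G)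

      lower-even-edges : EvenEdgesPresent (suc k) G → EvenEdgesPresent k H
      lower-even-edges hc j 1≤j j≤k-1 = ≤-trans (hc j 1≤j (<⇒≤ j<k)) (swap-monotone ¬AB ¬CD)
        where
        j<k : j < k
        j<k = ≤∸1⇒< 1≤j j≤k-1
        2j<d : 2 * j < d
        2j<d = *-monoʳ-< 2 j<k
        2≤2j : 2 ≤ 2 * j
        2≤2j = *-monoʳ-≤ 2 1≤j
        2j<top : 2 * j < 2 * suc k
        2j<top = <-trans 2j<d d<top
        ¬AB : ¬ SameType (v (2 * j)) (v (suc (2 * j))) A B
        ¬AB = ¬sameType-fst (≢-sym (start-fresh (2 * j) 2≤2j (<⇒≤ 2j<top)))
                            (≢-sym (start-fresh (suc (2 * j)) (m≤n⇒m≤1+n 2≤2j) 2j<top))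
        ¬CD : ¬ SameType (v (2 * j)) (v (suc (2 * j))) C D
        ¬CD s = steps-distinct (2 * j) d (≤-trans (s≤s z≤n) 2≤2j) 2j<d d<top (sameType-flip s)

      Stop : Set
      Stop = v 2 ≡ D ⊎ mult G A D ≡ 0

      stopped : Stop → Reduces (suc k) G H
      stopped stop = record
        { target-reduced = target-removed
        ; no-new-multi   = no-new-multi stop
        ; off-path-kept  = off-path-kept stop
        }
        where
        DA-first : ∀ {x y} → v 2 ≡ D → SameType x y D A → SameType x y (v 1) (v 2)
        DA-first {x} {y} v2≡D da = subst (SameType x y A) (sym v2≡D) (sameType-flip da)

        no-new-multi : Stop → ∀ x y → 2 ≤ mult H x y →
                       mult H x y ≤ mult G x y ⊎ OddEdgePresent (suc k) G x y
        no-new-multi _ x y 2≤H with swap-bound {x} {y} A≢B B≢D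
        ... | inj₁ H≤G               = inj₁ H≤G
        ... | inj₂ (H≤1+G , inj₁ bc) = inj₂ (odd-edge-at-top 2≤H H≤1+G bc)
        no-new-multi (inj₁ v2≡D) x y 2≤H | inj₂ (H≤1+G , inj₂ da) =
          inj₂ (1 , ≤-refl , s≤s z≤n , DA-first v2≡D da , ≤-pred (≤-trans 2≤H H≤1+G))
        no-new-multi (inj₂ AD≡0) x y 2≤H | inj₂ (H≤1+G , inj₂ da) =
          ⊥-elim (>⇒≢ (≤-pred (≤-trans 2≤H H≤1+G))
                      (trans (mult-resp-sameType G (sameType-flip da)) AD≡0))

        off-path-kept : Stop → ∀ x y → ¬ PathEdge (2 * suc k) x y → ¬ SameType x y A B →
                        KeptOrCreated (mult G x y) (mult H x y)
        off-path-kept _ x y ¬path ¬AB with sameType-dec x y D A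
        ... | no ¬da = inj₁ (off-path-untouched ¬path ¬AB ¬da)
        off-path-kept (inj₁ v2≡D) x y ¬path ¬AB | yes da =
          ⊥-elim (¬path (1 , ≤-refl , ≤-trans 2≤d (<⇒≤ d<top) , DA-first v2≡D da))
        off-path-kept (inj₂ AD≡0) x y ¬path ¬AB | yes da = inj₂ (G≡0 , trans H≡1+G (cong suc G≡0))
          where
          G≡0 = trans (mult-resp-sameType G (sameType-flip da)) AD≡0
          H≡1+G = swap-added ¬AB (¬path ∘ CD-on-path) (¬path ∘ BC-on-path) da

      composed : v 2 ≢ B → 2 ≤ mult G A B → 1 ≤ mult G A D →
                 ∀ {H'} → Reduces k H H' → Reduces (suc k) G H'
      composed v2≢B 2≤AB 1≤AD {H'} R = record
        { target-reduced = target-reduced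
        ; no-new-multi   = no-new-multi
        ; off-path-kept  = off-path-kept
        }
        where
        module R = Reduces R

        lift-path-edge : ∀ {x y} → PathEdge (2 * k) x y → PathEdge (2 * suc k) x y
        lift-path-edge = PathEdge-mono (<⇒≤ d<top)

        DA-restored : ∀ {x y} → SameType x y D A → mult H' x y ≡ mult G x y
        DA-restored {x} {y} da = begin
          mult H' x y ≡⟨ mult-resp-sameType H' (sameType-flip da) ⟩
          mult H' A D ≡⟨ suc-injective (trans R.target-reduced AD-added) ⟩
          mult G A D  ≡⟨ mult-resp-sameType G (sameType-flip da) ⟨
          mult G x y  ∎
          where open ≡-Reasoning

        target-reduced : suc (mult H' A B) ≡ mult G A B
        target-reduced with R.off-path-kept A B (closing-edge-off-path P v2≢B ∘ lift-path-edge)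
                                                (¬sameType-snd A≢D B≢D)
        ... | inj₁ H'≡H      = trans (cong suc H'≡H) target-removed
        ... | inj₂ (H≡0 , _) =
          ⊥-elim (<-irrefl refl (subst (2 ≤_) (trans (sym target-removed) (cong suc H≡0)) 2≤AB))

        no-new-multi : ∀ x y → 2 ≤ mult H' x y →
                       mult H' x y ≤ mult G x y ⊎ OddEdgePresent (suc k) G x y
        no-new-multi x y 2≤H' with R.no-new-multi x y 2≤H' | swap-bound {x} {y} A≢B B≢D
        ... | inj₁ H'≤H | inj₁ H≤G               = inj₁ (≤-trans H'≤H H≤G)
        ... | inj₁ H'≤H | inj₂ (H≤1+G , inj₁ bc) =
          inj₂ (odd-edge-at-top (≤-trans 2≤H' H'≤H) H≤1+G bc)
        ... | inj₁ _    | inj₂ (_ , inj₂ da)     = inj₁ (≤-reflexive (DA-restored da))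
        ... | inj₂ (j , 1≤j , j≤k , s , 1≤H) | inj₁ H≤G =
          inj₂ (j , 1≤j , m≤n⇒m≤1+n j≤k , s , ≤-trans 1≤H H≤G)
        ... | inj₂ (j , 1≤j , j≤k , s , _) | inj₂ (_ , inj₁ bc) =
          ⊥-elim (BC-not-earlier (odd-edge-on-path 1≤j j≤k s) bc)
        ... | inj₂ (j , 1≤j , j≤k , s , _) | inj₂ (_ , inj₂ da) =
          inj₂ (j , 1≤j , m≤n⇒m≤1+n j≤k , s ,
                subst (1 ≤_) (sym (mult-resp-sameType G (sameType-flip da))) 1≤AD)

        off-path-kept : ∀ x y → ¬ PathEdge (2 * suc k) x y → ¬ SameType x y A B →
                        KeptOrCreated (mult G x y) (mult H' x y)
        off-path-kept x y ¬path ¬AB with sameType-dec x y D A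
        ... | yes da = inj₁ (DA-restored da)
        ... | no ¬da = subst (λ g → KeptOrCreated g (mult H' x y))
                             (off-path-untouched ¬path ¬AB ¬da)
                             (R.off-path-kept x y (¬path ∘ lift-path-edge) (¬da ∘ sameType-flip))

  v2≢v2k⇒2≤k : ∀ {k} → 1 ≤ k → v 2 ≢ v (2 * k) → 2 ≤ k
  v2≢v2k⇒2≤k {suc zero}    _ v2≢v2 = ⊥-elim (v2≢v2 refl)
  v2≢v2k⇒2≤k {suc (suc k)} _ _     = s≤s (s≤s z≤n)

  reduce-closing-edge : ∀ k {G} → 2 ≤ k → PathConditions k → v 2 ≢ v (2 * k) →
                        EvenEdgesPresent k G → 2 ≤ mult G (v 1) (v (2 * k)) →
                        ∃[ H ] (AdmissibleSwaps G H × Reduces k G H)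
  reduce-closing-edge (suc k) {G} (s≤s 1≤k) P v2≢B hc hd =
    continue (swap-exists G adm) (v 2 ≟ᶠ D) (mult G A D ≟ 0)
    where
    open Level P 1≤k

    adm : Admissible G A B C D
    adm = admissible G hc hd

    step : ∀ {H} → SwapResult G A B C D H → AdmissibleSwap G H
    step res = A , B , C , D , adm , res

    continue : ∃[ H ] SwapResult G A B C D H → Dec (v 2 ≡ D) → Dec (mult G A D ≡ 0) →
               ∃[ H ] (AdmissibleSwaps G H × Reduces (suc k) G H)
    continue (H , res) (yes v2≡D) _          = H , step {H} res ◅ ε , stopped (inj₁ v2≡D)
      where open AfterSwap {G} {H} res
    continue (H , res) (no _)     (yes AD≡0) = H , step {H} res ◅ ε , stopped (inj₂ AD≡0)
      where open AfterSwap {G} {H} res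
    continue (H , res) (no v2≢D)  (no AD≢0)  =
      let H' , swaps , R = reduce-closing-edge k (v2≢v2k⇒2≤k 1≤k v2≢D)
                             (PathConditions-mono (n≤1+n k) P) v2≢D
                             (lower-even-edges hc) (AD-multiple 1≤AD)
      in H' , step {H} res ◅ swaps , composed v2≢B hd 1≤AD R
      where
      open AfterSwap {G} {H} res
      1≤AD : 1 ≤ mult G A D
      1≤AD = n≢0⇒n>0 AD≢0

lemma5p2 : ∀ {n} (G : Multigraph n) (m : ℕ) → 2 ≤ m → (v : ℕ → Fin n) →
    (∀ i → 2 ≤ i → i ≤ 2 * m → v 1 ≢ v i) →
    (∀ i → 1 ≤ i → i < 2 * m → v i ≢ v (suc i)) →
    (∀ i j → 1 ≤ i → i < j → j < 2 * m → ¬ SameType (v i) (v (suc i)) (v j) (v (suc j))) →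
    (∀ i → 1 ≤ i → i < 2 * m → ¬ SameType (v i) (v (suc i)) (v 1) (v (2 * m))) →
    (∀ j → 1 ≤ j → j ≤ m ∸ 1 → 1 ≤ mult G (v (2 * j)) (v (suc (2 * j)))) →
    2 ≤ mult G (v 1) (v (2 * m)) →
    ∃[ H ] (AdmissibleSwaps G H ×
      (suc (mult H (v 1) (v (2 * m))) ≡ mult G (v 1) (v (2 * m))) ×
      (∀ x y → 2 ≤ mult H x y →
         (mult H x y ≤ mult G x y) ⊎
         (∃[ j ] (1 ≤ j × j ≤ m × SameType x y (v (2 * j ∸ 1)) (v (2 * j)) × 1 ≤ mult G x y))))
lemma5p2 G m 2≤m v start-fresh steps-loopless steps-distinct closing-edge-distinct
         even-edges closing-edge-multiple =
  let H , swaps , R = reduce-closing-edge v m 2≤m P v2≢B even-edges closing-edge-multiple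
  in H , swaps , Reduces.target-reduced R , Reduces.no-new-multi R
  where
  P : PathConditions v m
  P = record
    { start-fresh    = start-fresh
    ; steps-loopless = steps-loopless
    ; steps-distinct = steps-distinct
    }

  v2≢B : v 2 ≢ v (2 * m)
  v2≢B v2≡B = closing-edge-distinct 1 ≤-refl (≤-trans 2≤m (m≤n*m m 2)) (inj₁ (refl , v2≡B))
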